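{- For every $t\in\mathbb{N}$, a partial half-graph $H$ with sides $L,R$ contains the half-graph $H_t$ as a semi-induced subgraph (with one side of $H_t$ embedded into $L$ and the other into $R$) if and only if $\mathrm{rk}_H(L,R)\ge t$.
   Context: The half-graph $H_t$ has vertices $v_1,\dots,v_t,w_1,\dots,w_t$ with $v_iw_j$ an edge iff $i\le j$. A bipartite graph with sides $A,B$ is a partial half-graph if for some $k$ there are injections $\alpha:A\to\{v_1,\dots,v_k\}$, $\beta:B\to\{w_1,\dots,w_k\}$ with $ab$ an edge iff $\alpha(a)\beta(b)$ is an edge of $H_k$. A bipartite graph $K$ with sides $A,B$ is a semi-induced subgraph of $H$ (with sides $L,R$) if there is an injection $\iota$ with $\iota(A)\subseteq L$, $\iota(B)\subseteq R$ such that for $a\in A,b\in B$, $ab\in E(K)$ iff $\iota(a)\iota(b)\in E(H)$. $\mathrm{rk}_H(L,R)$ is the rank over $\mathbb{F}_2$ of the $|L|\times|R|$ biadjacency matrix whose $(a,b)$ entry is $1$ iff $ab\in E(H)$. -}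

module Defs where

open import Data.Nat using (ℕ; zero; suc; _≤ᵇ_)
open import Data.Fin using (Fin; toℕ; zero; suc)
open import Data.Bool using (Bool; true; false; _xor_; _∧_)
open import Data.Product using (Σ; _×_; _,_)
open import Function.Definitions using (Injective)
open import Relation.Binary.PropositionalEquality using (_≡_)
open import Relation.Nullary using (¬_)

BiGraph : ℕ → ℕ → Set
BiGraph m n = Fin m → Fin n → Bool

-- The half-graph H_t: v_i w_j is an edge iff i ≤ j
-- (v_i ↦ i, w_j ↦ j, indices shifted to 0..t-1).
halfGraph : (t : ℕ) → BiGraph t t
halfGraph t i j = toℕ i ≤ᵇ toℕ j

IsPartialHalfGraph : {m n : ℕ} → BiGraph m n → Set
IsPartialHalfGraph {m} {n} H =
  Σ ℕ λ k → Σ (Fin m → Fin k) λ α → Σ (Fin n → Fin k) λ β →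
    Injective _≡_ _≡_ α × Injective _≡_ _≡_ β ×
    (∀ a b → H a b ≡ halfGraph k (α a) (β b))

SemiInduced : {p q m n : ℕ} → BiGraph p q → BiGraph m n → Set
SemiInduced {p} {q} {m} {n} K H =
  Σ (Fin p → Fin m) λ ι → Σ (Fin q → Fin n) λ κ →
    Injective _≡_ _≡_ ι × Injective _≡_ _≡_ κ ×
    (∀ a b → K a b ≡ H (ι a) (κ b))

xsum : (r : ℕ) → (Fin r → Bool) → Bool
xsum zero    f = false
xsum (suc r) f = f zero xor xsum r (λ i → f (suc i))

rowComb : {m n r : ℕ} → BiGraph m n → (Fin r → Fin m) → (Fin r → Bool) → Fin n → Bool
rowComb {r = r} H ρ S b = xsum r (λ i → S i ∧ H (ρ i) b)

RowsIndependent : {m n r : ℕ} → BiGraph m n → (Fin r → Fin m) → Set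
RowsIndependent H ρ = ∀ S → (∀ b → rowComb H ρ S b ≡ false) → ∀ i → S i ≡ false

-- rk_H(L,R) = r : the biadjacency matrix over F_2 has rank r, i.e. the maximum number of
-- linearly independent (distinct) rows is r.
HasRank : {m n : ℕ} → BiGraph m n → ℕ → Set
HasRank {m} {n} H r =
  (Σ (Fin r → Fin m) λ ρ → Injective _≡_ _≡_ ρ × RowsIndependent H ρ) ×
  (∀ (ρ : Fin (suc r) → Fin m) → Injective _≡_ _≡_ ρ → ¬ RowsIndependent H ρ)

-- The rows of an embedded half-graph H_t are triangular, hence independent over F₂, so t ≤ rk.
-- Conversely, in a partial half-graph the row of a is the set of columns b with α a ≤ β b, so
-- independent rows are nonzero and have pairwise distinct levels α a, and two rows with levels
-- α a < α a′ are told apart only by columns b with α a ≤ β b < α a′. Sorting r independent rows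
-- by level and pairing each with the leftmost column of its row therefore yields H_r.
module Submission where

open import Defs
open import Data.Nat using (ℕ; _≤_)
open import Function.Bundles using (_⇔_; mk⇔)

open import Data.Bool using (Bool; true; false; _xor_; _∧_)
open import Data.Bool.Properties
  using (xor-∧-commutativeRing; xor-identityʳ; ∧-comm; ∧-distribʳ-xor; ¬-not; T-≡)
  renaming (_≟_ to _≟ᵇ_)
open import Algebra.Bundles using (CommutativeRing)
open import Algebra.Properties.CommutativeSemigroup
  (CommutativeRing.+-commutativeSemigroup xor-∧-commutativeRing) using (interchange)
open import Data.Fin using (Fin; zero; suc; toℕ; punchIn; inject≤)
  renaming (_<_ to _<ᶠ_)
open import Data.Fin.Properties
  using (_≟_; any?; toℕ-injective; toℕ-inject≤; inject≤-injective; punchIn-injective; punchInᵢ≢i)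
open import Data.List using (List; filter; allFin)
open import Data.List.Extrema.Nat using (argmin; argmin-all; f[argmin]≤v⁺)
open import Data.List.Membership.Propositional.Properties using (∈-filter⁺; ∈-allFin)
open import Data.List.Relation.Unary.All.Properties using (all-filter)
open import Data.List.Relation.Unary.Any as Any using ()
open import Data.Nat using (_<_; _≤ᵇ_; _≤?_; s≤s)
open import Data.Nat.Properties
  using (≤-refl; ≤-trans; ≤-antisym; <⇒≤; <⇒≢; <⇒≱; ≮⇒≥; ≰⇒>; ≤∧≢⇒<; ≤-<-trans; ≤ᵇ⇒≤; ≤⇒≤ᵇ; m≤n⇒m<n∨m≡n)
open import Data.Product using (Σ-syntax; ∃; ∃-syntax; _×_; _,_; proj₁; proj₂)
open import Data.Sum using (inj₁; inj₂)
open import Function.Base using (_∘_)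
open import Function.Bundles using (Equivalence)
open import Function.Definitions using (Injective)
open import Relation.Binary.Core using (_Preserves_⟶_)
open import Relation.Binary.PropositionalEquality
  using (_≡_; _≢_; refl; sym; trans; cong; cong₂; subst; module ≡-Reasoning)
open import Relation.Nullary using (¬_; yes; no; does; contradiction)
open import Relation.Nullary.Decidable using (dec-true; dec-false; does-⇔)
open import Relation.Unary using (Pred; Decidable; U)
open import Relation.Unary.Properties using (U?)

open Equivalence using (to; from)

minimumOn : ∀ {n p} {P : Pred (Fin n) p} → Decidable P → (f : Fin n → ℕ) → ∃ P →
            Σ[ b ∈ Fin n ] P b × (∀ {b′} → P b′ → f b ≤ f b′)
minimumOn {n} P? f (b₀ , Pb₀) =
  b , argmin-all f Pb₀ (all-filter P? (allFin n)) ,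
  λ Pb′ → f[argmin]≤v⁺ b₀ candidates
            (inj₂ (Any.map (λ { refl → ≤-refl }) (∈-filter⁺ P? (∈-allFin _) Pb′)))
  where
  candidates : List (Fin n)
  candidates = filter P? (allFin n)

  b : Fin n
  b = argmin f b₀ candidates

increasing-reindexing : ∀ {r} (f : Fin r → ℕ) → Injective _≡_ _≡_ f →
                        Σ[ σ ∈ (Fin r → Fin r) ] (f ∘ σ) Preserves _<ᶠ_ ⟶ _<_
increasing-reindexing {ℕ.zero} f _ = (λ ()) , λ { {()} }
increasing-reindexing {ℕ.suc r} f f-inj = σ , σ-increasing
  where
  least : Σ[ i ∈ Fin (ℕ.suc r) ] U i × (∀ {j} → U j → f i ≤ f j)
  least = minimumOn U? f (zero , _)

  i₀ : Fin (ℕ.suc r)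
  i₀ = proj₁ least

  rest : Σ[ σ ∈ (Fin r → Fin r) ] (f ∘ punchIn i₀ ∘ σ) Preserves _<ᶠ_ ⟶ _<_
  rest = increasing-reindexing (f ∘ punchIn i₀) (punchIn-injective i₀ _ _ ∘ f-inj)

  σ : Fin (ℕ.suc r) → Fin (ℕ.suc r)
  σ zero    = i₀
  σ (suc i) = punchIn i₀ (proj₁ rest i)

  σ-increasing : (f ∘ σ) Preserves _<ᶠ_ ⟶ _<_
  σ-increasing {zero}  {suc j} _ =
    ≤∧≢⇒< (proj₂ (proj₂ least) _) (punchInᵢ≢i i₀ _ ∘ sym ∘ f-inj)
  σ-increasing {suc i} {suc j} (s≤s i<j) = proj₂ rest i<j

unitVector : ∀ {r} → Fin r → Fin r → Bool
unitVector i k = does (k ≟ i)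

xsum-cong : ∀ r {f g : Fin r → Bool} → (∀ k → f k ≡ g k) → xsum r f ≡ xsum r g
xsum-cong ℕ.zero    f≗g = refl
xsum-cong (ℕ.suc r) f≗g = cong₂ _xor_ (f≗g zero) (xsum-cong r (f≗g ∘ suc))

xsum-false : ∀ r → xsum r (λ _ → false) ≡ false
xsum-false ℕ.zero    = refl
xsum-false (ℕ.suc r) = xsum-false r

xsum-xor : ∀ r (f g : Fin r → Bool) → xsum r (λ k → f k xor g k) ≡ xsum r f xor xsum r g
xsum-xor ℕ.zero    f g = refl
xsum-xor (ℕ.suc r) f g = begin
  (f zero xor g zero) xor xsum r (λ k → f (suc k) xor g (suc k))
    ≡⟨ cong ((f zero xor g zero) xor_) (xsum-xor r (f ∘ suc) (g ∘ suc)) ⟩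
  (f zero xor g zero) xor (xsum r (f ∘ suc) xor xsum r (g ∘ suc))
    ≡⟨ interchange (f zero) (g zero) _ _ ⟩
  (f zero xor xsum r (f ∘ suc)) xor (g zero xor xsum r (g ∘ suc))
    ∎
  where open ≡-Reasoning

xsum-unitVector : ∀ {r} (i : Fin r) (g : Fin r → Bool) → xsum r (λ k → unitVector i k ∧ g k) ≡ g i
xsum-unitVector {ℕ.suc r} zero    g = trans (cong (g zero xor_) (xsum-false r)) (xor-identityʳ (g zero))
xsum-unitVector {ℕ.suc r} (suc i) g = xsum-unitVector i (g ∘ suc)

module _ {m n : ℕ} (H : BiGraph m n) where

  rowComb-xor : ∀ {r} (ρ : Fin r → Fin m) S S′ b →
                rowComb H ρ (λ k → S k xor S′ k) b ≡ rowComb H ρ S b xor rowComb H ρ S′ b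
  rowComb-xor {r} ρ S S′ b =
    trans (xsum-cong r (λ k → ∧-distribʳ-xor (H (ρ k) b) (S k) (S′ k))) (xsum-xor r _ _)

  rowComb-unitVector : ∀ {r} (ρ : Fin r → Fin m) i b → rowComb H ρ (unitVector i) b ≡ H (ρ i) b
  rowComb-unitVector ρ i b = xsum-unitVector i (λ k → H (ρ k) b)

  independent⇒nonzero-combination : ∀ {r} {ρ : Fin r → Fin m} → RowsIndependent H ρ →
                                     ∀ S i → S i ≡ true → ∃[ b ] rowComb H ρ S b ≡ true
  independent⇒nonzero-combination {ρ = ρ} indep S i Sᵢ with any? (λ b → rowComb H ρ S b ≟ᵇ true)
  ... | yes found = found
  ... | no  none  = contradiction (trans (sym Sᵢ) (indep S (λ b → ¬-not (none ∘ (b ,_))) i)) λ ()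

  independent⇒row-nonzero : ∀ {r} {ρ : Fin r → Fin m} → RowsIndependent H ρ →
                            ∀ i → ∃[ b ] H (ρ i) b ≡ true
  independent⇒row-nonzero {ρ = ρ} indep i
    with b , e ← independent⇒nonzero-combination indep (unitVector i) i (dec-true (i ≟ i) refl)
    = b , trans (sym (rowComb-unitVector ρ i b)) e

  independent⇒rows-distinct : ∀ {r} {ρ : Fin r → Fin m} → RowsIndependent H ρ →
                              ∀ {i j} → i ≢ j → ∃[ b ] H (ρ i) b xor H (ρ j) b ≡ true
  independent⇒rows-distinct {ρ = ρ} indep {i} {j} i≢j
    with b , e ← independent⇒nonzero-combination indep (λ k → unitVector i k xor unitVector j k) i
                   (cong₂ _xor_ (dec-true (i ≟ i) refl) (dec-false (i ≟ j) i≢j))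
    = b , (begin
      H (ρ i) b xor H (ρ j) b
        ≡⟨ sym (cong₂ _xor_ (rowComb-unitVector ρ i b) (rowComb-unitVector ρ j b)) ⟩
      rowComb H ρ (unitVector i) b xor rowComb H ρ (unitVector j) b
        ≡⟨ sym (rowComb-xor ρ (unitVector i) (unitVector j) b) ⟩
      rowComb H ρ (λ k → unitVector i k xor unitVector j k) b
        ≡⟨ e ⟩
      true ∎)
    where open ≡-Reasoning

  halfGraph-rowsIndependent : ∀ {t} {ι : Fin t → Fin m} {κ : Fin t → Fin n} →
                              (∀ i j → halfGraph t i j ≡ H (ι i) (κ j)) → RowsIndependent H ι
  halfGraph-rowsIndependent {ℕ.zero}  _ S _ ()
  -- Column κ zero is the unit vector at row zero, so it reads off S zero; then drop row zero.
  halfGraph-rowsIndependent {ℕ.suc t} {ι} {κ} embeds S vanishes = S≡false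
    where
    open ≡-Reasoning

    S₀≡false : S zero ≡ false
    S₀≡false = begin
      S zero                                        ≡⟨ sym (xsum-unitVector zero S) ⟩
      xsum (ℕ.suc t) (λ k → unitVector zero k ∧ S k) ≡⟨ xsum-cong (ℕ.suc t) column₀ ⟩
      rowComb H ι S (κ zero)                        ≡⟨ vanishes (κ zero) ⟩
      false                                         ∎
      where
      column₀ : ∀ k → unitVector zero k ∧ S k ≡ S k ∧ H (ι k) (κ zero)
      column₀ zero    = trans (∧-comm true (S zero)) (cong (S zero ∧_) (embeds zero zero))
      column₀ (suc k) = trans (∧-comm false (S (suc k))) (cong (S (suc k) ∧_) (embeds (suc k) zero))

    tail-vanishes : ∀ b → rowComb H (ι ∘ suc) (S ∘ suc) b ≡ false
    tail-vanishes b =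
      trans (cong (λ s → (s ∧ H (ι zero) b) xor rowComb H (ι ∘ suc) (S ∘ suc) b) (sym S₀≡false))
            (vanishes b)

    S≡false : ∀ i → S i ≡ false
    S≡false zero    = S₀≡false
    S≡false (suc i) = halfGraph-rowsIndependent
      (λ i j → trans (sym (≤ᵇ-suc (toℕ i) (toℕ j))) (embeds (suc i) (suc j))) (S ∘ suc) tail-vanishes i
      where
      ≤ᵇ-suc : ∀ a b → (ℕ.suc a ≤ᵇ ℕ.suc b) ≡ (a ≤ᵇ b)
      ≤ᵇ-suc ℕ.zero    _ = refl
      ≤ᵇ-suc (ℕ.suc a) _ = refl

  halfGraph-embedding⇒semiInduced : ∀ {t} {ι : Fin t → Fin m} {κ : Fin t → Fin n} →
                                    (∀ i j → halfGraph t i j ≡ H (ι i) (κ j)) →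
                                    SemiInduced (halfGraph t) H
  halfGraph-embedding⇒semiInduced {t} {ι} {κ} embeds = ι , κ , ι-injective , κ-injective , embeds
    where
    edge⇒≤ : ∀ i j → H (ι i) (κ j) ≡ true → toℕ i ≤ toℕ j
    edge⇒≤ i j e = ≤ᵇ⇒≤ (toℕ i) (toℕ j) (from T-≡ (trans (embeds i j) e))

    diagonal : ∀ i → H (ι i) (κ i) ≡ true
    diagonal i = trans (sym (embeds i i)) (dec-true (toℕ i ≤? toℕ i) ≤-refl)

    ι-injective : Injective _≡_ _≡_ ι
    ι-injective {i} {i′} eq = toℕ-injective (≤-antisym
      (edge⇒≤ i i′ (subst (λ a → H a (κ i′) ≡ true) (sym eq) (diagonal i′)))
      (edge⇒≤ i′ i (subst (λ a → H a (κ i) ≡ true) eq (diagonal i))))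

    κ-injective : Injective _≡_ _≡_ κ
    κ-injective {j} {j′} eq = toℕ-injective (≤-antisym
      (edge⇒≤ j j′ (subst (λ b → H (ι j) b ≡ true) eq (diagonal j)))
      (edge⇒≤ j′ j (subst (λ b → H (ι j′) b ≡ true) (sym eq) (diagonal j′))))

semiInduced-trans : ∀ {p q m n m′ n′} {K : BiGraph p q} {G : BiGraph m n} {H : BiGraph m′ n′} →
                    SemiInduced K G → SemiInduced G H → SemiInduced K H
semiInduced-trans (ι , κ , ι-inj , κ-inj , K≡G) (ι′ , κ′ , ι′-inj , κ′-inj , G≡H) =
  ι′ ∘ ι , κ′ ∘ κ , ι-inj ∘ ι′-inj , κ-inj ∘ κ′-inj , λ a b → trans (K≡G a b) (G≡H (ι a) (κ b))

halfGraph-semiInduced-≤ : ∀ {s t} → s ≤ t → SemiInduced (halfGraph s) (halfGraph t)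
halfGraph-semiInduced-≤ {s} {t} s≤t =
  embed , embed , injective , injective ,
  λ i j → cong₂ _≤ᵇ_ (sym (toℕ-inject≤ i s≤t)) (sym (toℕ-inject≤ j s≤t))
  where
  embed : Fin s → Fin t
  embed i = inject≤ i s≤t

  injective : Injective _≡_ _≡_ embed
  injective = inject≤-injective s≤t s≤t _ _

halfGraph-semiInduced-antitone : ∀ {s t m n} (H : BiGraph m n) → s ≤ t →
                                 SemiInduced (halfGraph t) H → SemiInduced (halfGraph s) H
halfGraph-semiInduced-antitone H s≤t = semiInduced-trans {G = halfGraph _} {H} (halfGraph-semiInduced-≤ s≤t)

semiInduced-halfGraph⇒≤rank : ∀ {m n t r} (H : BiGraph m n) → HasRank H r →
                              SemiInduced (halfGraph t) H → t ≤ r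
semiInduced-halfGraph⇒≤rank H (_ , maximal) Hₜ↪H = ≮⇒≥ λ r<t →
  tooLarge (halfGraph-semiInduced-antitone H r<t Hₜ↪H)
  where
  tooLarge : ¬ SemiInduced (halfGraph _) H
  tooLarge (ι , _ , ι-inj , _ , embeds) = maximal ι ι-inj (halfGraph-rowsIndependent H embeds)

module PartialHalfGraph {m n k : ℕ} (H : BiGraph m n) (α : Fin m → Fin k) (β : Fin n → Fin k)
                        (H≡ : ∀ a b → H a b ≡ halfGraph k (α a) (β b)) where

  αℕ : Fin m → ℕ
  αℕ = toℕ ∘ α

  βℕ : Fin n → ℕ
  βℕ = toℕ ∘ β

  edge⇔ : ∀ {a b} → H a b ≡ true ⇔ αℕ a ≤ βℕ b
  edge⇔ {a} {b} = mk⇔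
    (λ e → ≤ᵇ⇒≤ (αℕ a) (βℕ b) (from T-≡ (trans (sym (H≡ a b)) e)))
    (λ a≤b → trans (H≡ a b) (to T-≡ (≤⇒≤ᵇ a≤b)))

  separating-column : ∀ {a a′ b} → αℕ a < αℕ a′ → H a b xor H a′ b ≡ true →
                      αℕ a ≤ βℕ b × βℕ b < αℕ a′
  separating-column {a} {a′} {b} a<a′ differ with H a b in e | H a′ b in e′
  ... | true  | false = to edge⇔ e , ≰⇒> (λ a′≤b → contradiction (trans (sym e′) (from edge⇔ a′≤b)) λ ())
  ... | false | true  = contradiction (trans (sym e) (from edge⇔ (≤-trans (<⇒≤ a<a′) (to edge⇔ e′)))) λ ()
  separating-column _ () | true  | true
  separating-column _ () | false | false

  halfGraph-embedding : ∀ {t} {ι : Fin t → Fin m} {κ : Fin t → Fin n} →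
                        (∀ i j → toℕ i ≤ toℕ j ⇔ αℕ (ι i) ≤ βℕ (κ j)) →
                        ∀ i j → halfGraph t i j ≡ H (ι i) (κ j)
  -- halfGraph t i j is definitionally does (toℕ i ≤? toℕ j).
  halfGraph-embedding {ι = ι} {κ} ≤⇔edge i j =
    trans (does-⇔ (≤⇔edge i j) (toℕ i ≤? toℕ j) (αℕ (ι i) ≤? βℕ (κ j))) (sym (H≡ (ι i) (κ j)))

  independentRows⇒semiInduced-halfGraph : ∀ {r} {ρ : Fin r → Fin m} → Injective _≡_ _≡_ α → Injective _≡_ _≡_ ρ →
                              RowsIndependent H ρ → SemiInduced (halfGraph r) H
  independentRows⇒semiInduced-halfGraph {r} {ρ} α-inj ρ-inj indep =
    halfGraph-embedding⇒semiInduced H (halfGraph-embedding ≤⇔edge)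
    where
    sorted : Σ[ σ ∈ (Fin r → Fin r) ] (αℕ ∘ ρ ∘ σ) Preserves _<ᶠ_ ⟶ _<_
    sorted = increasing-reindexing (αℕ ∘ ρ) (ρ-inj ∘ α-inj ∘ toℕ-injective)

    σ : Fin r → Fin r
    σ = proj₁ sorted

    ι : Fin r → Fin m
    ι = ρ ∘ σ

    ι-increasing : ∀ {i j} → i <ᶠ j → αℕ (ι i) < αℕ (ι j)
    ι-increasing = proj₂ sorted

    ι-monotone : ∀ {i j : Fin r} → toℕ i ≤ toℕ j → αℕ (ι i) ≤ αℕ (ι j)
    ι-monotone i≤j with m≤n⇒m<n∨m≡n i≤j
    ... | inj₁ i<j = <⇒≤ (ι-increasing i<j)
    ... | inj₂ i≡j rewrite toℕ-injective i≡j = ≤-refl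

    leftmost : ∀ i → Σ[ b ∈ Fin n ] H (ι i) b ≡ true × (∀ {b′} → H (ι i) b′ ≡ true → βℕ b ≤ βℕ b′)
    leftmost i = minimumOn (λ b → H (ι i) b ≟ᵇ true) βℕ (independent⇒row-nonzero H indep (σ i))

    κ : Fin r → Fin n
    κ i = proj₁ (leftmost i)

    κ-below : ∀ {i j} → j <ᶠ i → βℕ (κ j) < αℕ (ι i)
    κ-below {i} {j} j<i
      with b , differ ← independent⇒rows-distinct H indep {σ j} {σ i}
                          (λ eq → <⇒≢ (ι-increasing j<i) (cong (αℕ ∘ ρ) eq))
      with ιj≤b , b<ιi ← separating-column (ι-increasing j<i) differ
      = ≤-<-trans (proj₂ (proj₂ (leftmost j)) (from edge⇔ ιj≤b)) b<ιi

    ≤⇔edge : ∀ i j → toℕ i ≤ toℕ j ⇔ αℕ (ι i) ≤ βℕ (κ j)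
    ≤⇔edge i j = mk⇔
      (λ i≤j → ≤-trans (ι-monotone i≤j) (to edge⇔ (proj₁ (proj₂ (leftmost j)))))
      (λ ιi≤κj → ≮⇒≥ (λ j<i → <⇒≱ (κ-below j<i) ιi≤κj))

  ≤rank⇒semiInduced-halfGraph : ∀ {t r} → Injective _≡_ _≡_ α → HasRank H r → t ≤ r →
                                SemiInduced (halfGraph t) H
  ≤rank⇒semiInduced-halfGraph α-inj ((ρ , ρ-inj , indep) , _) t≤r =
    halfGraph-semiInduced-antitone H t≤r (independentRows⇒semiInduced-halfGraph α-inj ρ-inj indep)

lemma5p3 : (t : ℕ) → {m n : ℕ} → (H : BiGraph m n) → IsPartialHalfGraph H →
    (r : ℕ) → HasRank H r →
    (SemiInduced (halfGraph t) H ⇔ t ≤ r)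
lemma5p3 t H (k , α , β , α-inj , _ , H≡) r rank =
  mk⇔ (semiInduced-halfGraph⇒≤rank H rank) (PartialHalfGraph.≤rank⇒semiInduced-halfGraph H α β H≡ α-inj rank)
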